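{- Let $G=(V,S,U)$ be a graph with $n$ vertices whose underlying graph is $2$-edge connected, let $(P_0,\ldots,P_t)$ be the non-trivial ears of an ear decomposition of $G$, and let $\mathcal{P}$ be the set of ears $P_i$ with $i\ge1$ of size at least $3$ (i.e., with at least $3$ edges). Then $G$ has an unsafe spanning connected subgraph with at most $2n-(|V(P_0)|+|\mathcal{P}|)$ edges.
   Context: A graph $G=(V,S,U)$ is an undirected graph whose edge set $S\cup U$ is partitioned into safe edges $S$ and unsafe edges $U$. An edge set $T\subseteq S\cup U$ is an unsafe spanning connected subgraph of $G$ if $(V,T)$ is connected and, for every unsafe edge $e\in T\cap U$, $(V,T\setminus\{e\})$ is connected. An ear decomposition of a $2$-edge connected graph $G$ is a sequence $(P_0,P_1,\ldots,P_t)$ where $P_0$ is a cycle and each $P_i$, $i\ge1$, is a path or a cycle such that: the $P_i$ are pairwise edge-disjoint; letting $G_i$ be the graph with vertex set $\bigcup_{j\le i}V(P_j)$ and edge set $\bigcup_{j\le i}E(P_j)$, for $i\ge1$, if $P_i$ is a cycle then it has exactly one vertex in common with $V(G_{i-1})$, and if $P_i$ is a path then $V(P_i)\cap V(G_{i-1})$ consists exactly of the two endpoints of $P_i$; and $G_t=G$. The size of an ear is its number of edges; an ear of size one is trivial, otherwise non-trivial. -}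

module Defs where

open import Data.Nat using (ℕ; zero; suc; _+_; _*_; _∸_; _≤_; _<_; _≤?_)
open import Data.Fin using (Fin; zero; suc; inject₁; fromℕ; toℕ; _≟_)
open import Data.Fin.Subset using (Subset; _∈_; ∣_∣)
open import Data.Fin.Properties using (any?)
open import Data.List using (List; length; filter)
open import Data.List using (allFin) public
open import Data.Bool using (Bool; true; false)
open import Data.Product using (Σ; _×_; _,_; ∃; ∃-syntax)
open import Data.Sum using (_⊎_)
open import Relation.Binary.PropositionalEquality using (_≡_; _≢_)
open import Relation.Binary.Construct.Closure.ReflexiveTransitive using (Star)
open import Function.Definitions using (Injective)

-- A graph G = (V, S, U): a finite undirected multigraph (no loops) on the
-- vertex set Fin n with edges Fin m; each edge is safe or unsafe.

record Graph : Set where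
  field
    n      : ℕ
    m      : ℕ
    ends   : Fin m → Fin n × Fin n
    noLoop : ∀ e → Σ.proj₁ (ends e) ≢ Σ.proj₂ (ends e)
    safe   : Fin m → Bool        -- true: e ∈ S,  false: e ∈ U

open Graph public

Vertex : Graph → Set
Vertex G = Fin (n G)

Edge : Graph → Set
Edge G = Fin (m G)

IsUnsafeEdge : (G : Graph) → Edge G → Set
IsUnsafeEdge G e = safe G e ≡ false

Joins : (G : Graph) → Edge G → Vertex G → Vertex G → Set
Joins G e u v =
  (Σ.proj₁ (ends G e) ≡ u × Σ.proj₂ (ends G e) ≡ v) ⊎
  (Σ.proj₁ (ends G e) ≡ v × Σ.proj₂ (ends G e) ≡ u)

EdgePred : Graph → Set₁
EdgePred G = Edge G → Set

Adj : (G : Graph) → EdgePred G → Vertex G → Vertex G → Set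
Adj G T u v = ∃[ e ] (T e × Joins G e u v)

Connected : (G : Graph) → EdgePred G → Set
Connected G T = ∀ (u v : Vertex G) → Star (Adj G T) u v

AllEdges : (G : Graph) → EdgePred G
AllEdges G e = Data.Unit.⊤
  where import Data.Unit

Without : (G : Graph) → EdgePred G → Edge G → EdgePred G
Without G T e f = T f × f ≢ e

TwoEdgeConnected : Graph → Set
TwoEdgeConnected G =
  Connected G (AllEdges G) ×
  (∀ e → Connected G (Without G (AllEdges G) e))

UnsafeSpanningConnected : (G : Graph) → Subset (m G) → Set
UnsafeSpanningConnected G T =
  Connected G (λ e → e ∈ T) ×
  (∀ e → e ∈ T → IsUnsafeEdge G e → Connected G (Without G (λ f → f ∈ T) e))

record Walk (G : Graph) : Set where
  field
    size    : ℕ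
    verts   : Fin (suc size) → Vertex G
    edges   : Fin size → Edge G
    incid   : ∀ i → Joins G (edges i) (verts (inject₁ i)) (verts (suc i))

open Walk public

firstV : ∀ {G} → Walk G → Vertex G
firstV W = verts W zero

lastV : ∀ {G} → Walk G → Vertex G
lastV W = verts W (fromℕ (size W))

IsPath : ∀ {G} → Walk G → Set
IsPath W = 1 ≤ size W × Injective _≡_ _≡_ (verts W) × Injective _≡_ _≡_ (edges W)

IsCycle : ∀ {G} → Walk G → Set
IsCycle W =
  2 ≤ size W × firstV W ≡ lastV W ×
  Injective _≡_ _≡_ (λ (i : Fin (size W)) → verts W (inject₁ i)) ×
  Injective _≡_ _≡_ (edges W)

OnWalk : ∀ {G} → Vertex G → Walk G → Set
OnWalk v W = ∃[ p ] verts W p ≡ v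

EdgeOnWalk : ∀ {G} → Edge G → Walk G → Set
EdgeOnWalk e W = ∃[ p ] edges W p ≡ e

-- v ∈ V(G_{i-1}), i.e. v lies on some ear P_j with j < i
InPrefix : ∀ {G t} → (Fin (suc t) → Walk G) → Fin (suc t) → Vertex G → Set
InPrefix P i v = ∃[ j ] (toℕ j < toℕ i × OnWalk v (P j))

record EarDecomposition (G : Graph) : Set where
  field
    t        : ℕ
    ear      : Fin (suc t) → Walk G
    ear0     : IsCycle (ear zero)
    earShape : ∀ i → IsPath (ear (suc i)) ⊎ IsCycle (ear (suc i))
    disjoint : ∀ i j p q → i ≢ j → edges (ear i) p ≢ edges (ear j) q
    cycleAttach : ∀ i → IsCycle (ear (suc i)) →
      ∃[ v ] ((OnWalk v (ear (suc i)) × InPrefix ear (suc i) v) ×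
              (∀ w → OnWalk w (ear (suc i)) → InPrefix ear (suc i) w → w ≡ v))
    pathAttach : ∀ i → IsPath (ear (suc i)) →
      ∀ w → OnWalk w (ear (suc i)) →
        (InPrefix ear (suc i) w → (w ≡ firstV (ear (suc i)) ⊎ w ≡ lastV (ear (suc i)))) ×
        ((w ≡ firstV (ear (suc i)) ⊎ w ≡ lastV (ear (suc i))) → InPrefix ear (suc i) w)
    -- G_t = G
    coversV  : ∀ v → ∃[ i ] OnWalk v (ear i)
    coversE  : ∀ e → ∃[ i ] EdgeOnWalk e (ear i)

open EarDecomposition public

numVerts : ∀ {G} → Walk G → ℕ
numVerts {G} W = length (filter (λ v → any? (λ p → verts W p ≟ v)) (allFin (n G)))

numLongEars : ∀ {G} → EarDecomposition G → ℕ
numLongEars D = length (filter (λ i → 3 ≤? size (ear D (suc i))) (allFin (t D)))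

-- Keep exactly the edges of the ears with at least two edges.  Every vertex lies on such an ear
-- or is an endpoint of a trivial ear, so the kept edges connect G.  A kept edge lies on its ear,
-- whose two ends are joined either directly (a cycle) or through earlier kept ears (a path); the
-- rest of that closed route survives the removal of the edge, whether it is safe or not.
-- Counting: P₀ has |P₀| vertices and each later ear Pᵢ brings |Pᵢ| - 1 new ones, so
-- |P₀| + Σ (|Pᵢ| - 1) ≤ n.  A later ear contributes at most 2(|Pᵢ| - 1) - [|Pᵢ| ≥ 3] kept edges
-- (none if trivial), so |T| + |V(P₀)| + |𝒫| ≤ 2|P₀| + 2 Σ (|Pᵢ| - 1) ≤ 2n.

module Submission where

open import Defs
open import Data.Nat using (ℕ; zero; suc; _+_; _*_; _∸_; _≤_; _<_; _≤?_; _≟_; z≤n; s≤s; z<s; s<s)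
open import Data.Nat.Properties
open import Data.Nat.Tactic.RingSolver using (solve-∀)
open import Data.Fin as Fin using (Fin; zero; suc; inject₁; fromℕ; toℕ; lower₁; punchIn; splitAt)
import Data.Fin.Properties as Finₚ
open import Data.Fin.Subset using (Subset; _∈_; _∪_; ⁅_⁆; ⊥; ∣_∣; inside; outside)
open import Data.Fin.Subset.Properties
  using (∣⁅x⁆∣≡1; ∣⊥∣≡0; ∉⊥; x∈⁅x⁆; x∈⁅y⁆⇒x≡y; x∈p∪q⁺; x∈p∪q⁻; ∣p∣≤∣x∷p∣; drop-there)
open import Data.Vec using ([]; _∷_; here)
open import Data.List using (length; filter; tabulate)
open import Data.Sum using (_⊎_; inj₁; inj₂; [_,_]′; swap)
open import Data.Product using (_×_; _,_; proj₁; proj₂; ∃-syntax)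
open import Data.Empty using (⊥-elim)
open import Function using (_∘_; Injective)
open import Function.Bundles using (Injection)
open import Function.Properties.Inverse using (↔⇒↣)
open import Relation.Binary.PropositionalEquality
open import Relation.Binary.Definitions using (tri<; tri≈; tri>)
open import Relation.Binary.Construct.Closure.ReflexiveTransitive as Star using (Star; ε; _◅_; _◅◅_; _⋆)
open import Relation.Nullary using (Dec; yes; no; ¬_)
open import Relation.Unary using (Decidable)
open import Algebra.Properties.CommutativeMonoid.Sum +-0-commutativeMonoid using (sum-syntax; ∑-distrib-+)
open import Algebra.Properties.Semiring.Sum +-*-semiring using (*-distribˡ-sum)

indicator : ∀ {p} {P : Set p} → Dec P → ℕ
indicator (yes _) = 1
indicator (no _)  = 0

∑-mono-≤ : ∀ {k} {f g : Fin k → ℕ} → (∀ i → f i ≤ g i) → ∑[ i < k ] f i ≤ ∑[ i < k ] g i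
∑-mono-≤ {zero}  f≤g = z≤n
∑-mono-≤ {suc k} f≤g = +-mono-≤ (f≤g zero) (∑-mono-≤ (f≤g ∘ suc))

length-filter-tabulate : ∀ {a p} {A : Set a} {P : A → Set p} (P? : Decidable P) {k} (f : Fin k → A) →
  length (filter P? (tabulate f)) ≡ ∑[ i < k ] indicator (P? (f i))
length-filter-tabulate P? {zero}  f = refl
length-filter-tabulate P? {suc k} f with P? (f zero)
... | yes _ = cong suc (length-filter-tabulate P? (f ∘ suc))
... | no _  = length-filter-tabulate P? (f ∘ suc)

length-filter-tabulate≤ : ∀ {a p} {A : Set a} {P : A → Set p} (P? : Decidable P) {k} (f : Fin k → A)
  (S : Subset k) → (∀ i → P (f i) → i ∈ S) → length (filter P? (tabulate f)) ≤ ∣ S ∣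
length-filter-tabulate≤ P? {zero} f [] _ = z≤n
length-filter-tabulate≤ P? {suc k} f (x ∷ S) P⊆S with P? (f zero)
... | no _ =
  ≤-trans (length-filter-tabulate≤ P? (f ∘ suc) S (λ i → drop-there ∘ P⊆S (suc i))) (∣p∣≤∣x∷p∣ x S)
... | yes Pf₀ with x | P⊆S zero Pf₀
...   | inside | here =
  s≤s (length-filter-tabulate≤ P? (f ∘ suc) S (λ i → drop-there ∘ P⊆S (suc i)))

∣p∪q∣≤∣p∣+∣q∣ : ∀ {n} (p q : Subset n) → ∣ p ∪ q ∣ ≤ ∣ p ∣ + ∣ q ∣
∣p∪q∣≤∣p∣+∣q∣ []            []            = z≤n
∣p∪q∣≤∣p∣+∣q∣ (inside ∷ p)  (inside ∷ q)  =
  s≤s (≤-trans (∣p∪q∣≤∣p∣+∣q∣ p q) (+-monoʳ-≤ ∣ p ∣ (n≤1+n ∣ q ∣)))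
∣p∪q∣≤∣p∣+∣q∣ (inside ∷ p)  (outside ∷ q) = s≤s (∣p∪q∣≤∣p∣+∣q∣ p q)
∣p∪q∣≤∣p∣+∣q∣ (outside ∷ p) (inside ∷ q)  =
  ≤-trans (s≤s (∣p∪q∣≤∣p∣+∣q∣ p q)) (≤-reflexive (sym (+-suc ∣ p ∣ ∣ q ∣)))
∣p∪q∣≤∣p∣+∣q∣ (outside ∷ p) (outside ∷ q) = ∣p∪q∣≤∣p∣+∣q∣ p q

image : ∀ {k n} → (Fin k → Fin n) → Subset n
image {zero}  f = ⊥
image {suc k} f = ⁅ f zero ⁆ ∪ image (f ∘ suc)

∣image∣≤ : ∀ {k n} (f : Fin k → Fin n) → ∣ image f ∣ ≤ k
∣image∣≤ {zero} {n} f = ≤-reflexive (∣⊥∣≡0 n)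
∣image∣≤ {suc k}    f = begin
  ∣ ⁅ f zero ⁆ ∪ image (f ∘ suc) ∣
    ≤⟨ ∣p∪q∣≤∣p∣+∣q∣ ⁅ f zero ⁆ (image (f ∘ suc)) ⟩
  ∣ ⁅ f zero ⁆ ∣ + ∣ image (f ∘ suc) ∣
    ≤⟨ +-mono-≤ (≤-reflexive (∣⁅x⁆∣≡1 (f zero))) (∣image∣≤ (f ∘ suc)) ⟩
  suc k ∎
  where open ≤-Reasoning

f∈image : ∀ {k n} (f : Fin k → Fin n) i → f i ∈ image f
f∈image f zero    = x∈p∪q⁺ (inj₁ (x∈⁅x⁆ (f zero)))
f∈image f (suc i) = x∈p∪q⁺ (inj₂ (f∈image (f ∘ suc) i))

∈image⁻ : ∀ {k n} (f : Fin k → Fin n) {x} → x ∈ image f → ∃[ i ] f i ≡ x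
∈image⁻ {zero}  f x∈ = ⊥-elim (∉⊥ x∈)
∈image⁻ {suc k} f x∈ with x∈p∪q⁻ ⁅ f zero ⁆ (image (f ∘ suc)) x∈
... | inj₁ x∈⁅f₀⁆ = zero , sym (x∈⁅y⁆⇒x≡y (f zero) x∈⁅f₀⁆)
... | inj₂ x∈rest with ∈image⁻ (f ∘ suc) x∈rest
...   | i , fi≡x = suc i , fi≡x

module _ {a} {A : Set a} where

  [,]-injective : ∀ {m n} {f : Fin m → A} {g : Fin n → A} → Injective _≡_ _≡_ f → Injective _≡_ _≡_ g →
    (∀ i j → f i ≢ g j) → Injective _≡_ _≡_ [ f , g ]′
  [,]-injective f-inj g-inj f≢g {inj₁ i} {inj₁ j} eq = cong inj₁ (f-inj eq)
  [,]-injective f-inj g-inj f≢g {inj₁ i} {inj₂ j} eq = ⊥-elim (f≢g i j eq)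
  [,]-injective f-inj g-inj f≢g {inj₂ i} {inj₁ j} eq = ⊥-elim (f≢g j i (sym eq))
  [,]-injective f-inj g-inj f≢g {inj₂ i} {inj₂ j} eq = cong inj₂ (g-inj eq)

  flatten : ∀ {k} (c : Fin k → ℕ) → ((i : Fin k) → Fin (c i) → A) → Fin (∑[ i < k ] c i) → A
  flatten {zero}  c g ()
  flatten {suc k} c g = [ g zero , flatten (c ∘ suc) (g ∘ suc) ]′ ∘ splitAt (c zero)

  flatten-index : ∀ {k} (c : Fin k → ℕ) (g : (i : Fin k) → Fin (c i) → A) q →
    ∃[ i ] ∃[ r ] flatten c g q ≡ g i r
  flatten-index {suc k} c g q with splitAt (c zero) q
  ... | inj₁ r = zero , r , refl
  ... | inj₂ q′ with flatten-index (c ∘ suc) (g ∘ suc) q′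
  ...   | i , r , eq = suc i , r , eq

  flatten-covers : ∀ {k} (c : Fin k → ℕ) (g : (i : Fin k) → Fin (c i) → A) i r →
    ∃[ q ] flatten c g q ≡ g i r
  flatten-covers {suc k} c g zero r =
    r Fin.↑ˡ _ , cong [ g zero , _ ]′ (Finₚ.splitAt-↑ˡ (c zero) r _)
  flatten-covers {suc k} c g (suc i) r with flatten-covers (c ∘ suc) (g ∘ suc) i r
  ... | q , eq = c zero Fin.↑ʳ q , trans (cong [ g zero , _ ]′ (Finₚ.splitAt-↑ʳ (c zero) _ q)) eq

  flatten-injective : ∀ {k} (c : Fin k → ℕ) (g : (i : Fin k) → Fin (c i) → A) →
    (∀ i → Injective _≡_ _≡_ (g i)) → (∀ i j r s → i ≢ j → g i r ≢ g j s) →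
    Injective _≡_ _≡_ (flatten c g)
  flatten-injective {zero}  c g g-inj g-disj {()}
  flatten-injective {suc k} c g g-inj g-disj =
    Injection.injective (↔⇒↣ Finₚ.+↔⊎) ∘ [,]-injective (g-inj zero) rest-inj rest-disj
    where
    rest-inj : Injective _≡_ _≡_ (flatten (c ∘ suc) (g ∘ suc))
    rest-inj = flatten-injective (c ∘ suc) (g ∘ suc) (g-inj ∘ suc)
      (λ i j r s i≢j → g-disj (suc i) (suc j) r s (i≢j ∘ Finₚ.suc-injective))
    rest-disj : ∀ r q → g zero r ≢ flatten (c ∘ suc) (g ∘ suc) q
    rest-disj r q eq with flatten-index (c ∘ suc) (g ∘ suc) q
    ... | i , s , eq′ = g-disj zero (suc i) r s (λ ()) (trans eq eq′)

∑-injective⇒≤ : ∀ {k n} (c : Fin k → ℕ) (g : (i : Fin k) → Fin (c i) → Fin n) →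
  (∀ i → Injective _≡_ _≡_ (g i)) → (∀ i j r s → i ≢ j → g i r ≢ g j s) → ∑[ i < k ] c i ≤ n
∑-injective⇒≤ c g g-inj g-disj = Finₚ.injective⇒≤ (flatten-injective c g g-inj g-disj)

module Reachability (G : Graph) where

  Reach : EdgePred G → Vertex G → Vertex G → Set
  Reach T = Star (Adj G T)

  Joins-sym : ∀ {e u v} → Joins G e u v → Joins G e v u
  Joins-sym = swap

  Joins-unique : ∀ {e x y u v} → Joins G e x y → Joins G e u v → (x ≡ u × y ≡ v) ⊎ (x ≡ v × y ≡ u)
  Joins-unique (inj₁ (refl , refl)) (inj₁ (refl , refl)) = inj₁ (refl , refl)
  Joins-unique (inj₁ (refl , refl)) (inj₂ (refl , refl)) = inj₂ (refl , refl)
  Joins-unique (inj₂ (refl , refl)) (inj₁ (refl , refl)) = inj₂ (refl , refl)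
  Joins-unique (inj₂ (refl , refl)) (inj₂ (refl , refl)) = inj₁ (refl , refl)

  Reach-sym : ∀ {T u v} → Reach T u v → Reach T v u
  Reach-sym = Star.reverse λ (e , e∈T , j) → e , e∈T , Joins-sym j

  Reach-mono : ∀ {T T′} → (∀ e → T e → T′ e) → ∀ {u v} → Reach T u v → Reach T′ u v
  Reach-mono T⊆T′ = Star.map λ (e , e∈T , j) → e , T⊆T′ e e∈T , j

  module _ {R : EdgePred G} where

    private
      Incident : ∀ {s} → (Fin (suc s) → Vertex G) → (Fin s → Edge G) → Set
      Incident vs es = ∀ i → Joins G (es i) (vs (inject₁ i)) (vs (suc i))

      reach-prefix : ∀ s (vs : Fin (suc s) → Vertex G) (es : Fin s → Edge G) → Incident vs es →
        ∀ p → (∀ i → toℕ i < toℕ p → R (es i)) → Reach R (vs zero) (vs p)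
      reach-prefix s       vs es inc zero    ok = ε
      reach-prefix (suc s) vs es inc (suc p) ok =
        (es zero , ok zero z<s , inc zero) ◅
        reach-prefix s (vs ∘ suc) (es ∘ suc) (inc ∘ suc) p (λ i i<p → ok (suc i) (s<s i<p))

      reach-suffix : ∀ s (vs : Fin (suc s) → Vertex G) (es : Fin s → Edge G) → Incident vs es →
        ∀ p → (∀ i → toℕ p ≤ toℕ i → R (es i)) → Reach R (vs p) (vs (fromℕ s))
      reach-suffix s       vs es inc zero    ok = reach-prefix s vs es inc (fromℕ s) (λ i _ → ok i z≤n)
      reach-suffix (suc s) vs es inc (suc p) ok =
        reach-suffix s (vs ∘ suc) (es ∘ suc) (inc ∘ suc) p (λ i p≤i → ok (suc i) (s≤s p≤i))

    walk-reach : (W : Walk G) → (∀ i → R (edges W i)) → ∀ p q → Reach R (verts W p) (verts W q)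
    walk-reach W ok p q = Reach-sym (prefix p) ◅◅ prefix q
      where
      prefix : ∀ p → Reach R (firstV W) (verts W p)
      prefix p = reach-prefix (size W) (verts W) (edges W) (incid W) p (λ i _ → ok i)

    walk-bypass : (W : Walk G) (p : Fin (size W)) → (∀ i → i ≢ p → R (edges W i)) →
      Reach R (lastV W) (firstV W) → Reach R (verts W (suc p)) (verts W (inject₁ p))
    walk-bypass W p ok last⇝first =
      reach-suffix (size W) (verts W) (edges W) (incid W) (suc p) (λ i p<i → ok i λ { refl → n≮n _ p<i })
      ◅◅ last⇝first ◅◅
      reach-prefix (size W) (verts W) (edges W) (incid W) (inject₁ p)
        (λ i i<p → ok i λ { refl → n≮n _ (subst (toℕ i <_) (Finₚ.toℕ-inject₁ i) i<p) })

nontrivialSize : ℕ → ℕ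
nontrivialSize (suc (suc k)) = suc (suc k)
nontrivialSize _             = 0

nontrivialSize≤ : ∀ s → nontrivialSize s ≤ s
nontrivialSize≤ (suc (suc k)) = ≤-refl
nontrivialSize≤ (suc zero)    = z≤n
nontrivialSize≤ zero          = z≤n

from-nontrivialSize : ∀ s → Fin (nontrivialSize s) → Fin s
from-nontrivialSize (suc (suc k)) r = r

from-nontrivialSize⇒2≤ : ∀ s → Fin (nontrivialSize s) → 2 ≤ s
from-nontrivialSize⇒2≤ (suc (suc k)) _ = s≤s (s≤s z≤n)

from-nontrivialSize-surjective : ∀ {s} → 2 ≤ s → ∀ r → ∃[ r′ ] from-nontrivialSize s r′ ≡ r
from-nontrivialSize-surjective {suc (suc k)} _          r = r , refl
from-nontrivialSize-surjective {suc zero}    (s≤s ()) _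

nontrivialSize+long≤ : ∀ s → nontrivialSize s + indicator (3 ≤? s) ≤ 2 * (s ∸ 1)
nontrivialSize+long≤ 0 = z≤n
nontrivialSize+long≤ 1 = z≤n
nontrivialSize+long≤ 2 = ≤-refl
nontrivialSize+long≤ (suc (suc (suc k))) = begin
  3 + k + 1   ≡⟨ +-comm (3 + k) 1 ⟩
  4 + k       ≤⟨ +-monoʳ-≤ 4 (m≤n*m k 2) ⟩
  4 + 2 * k   ≡⟨ *-distribˡ-+ 2 2 k ⟨
  2 * (2 + k) ∎
  where open ≤-Reasoning

closed-position : ∀ {a} {A : Set a} {s} (vs : Fin (suc s) → A) → 0 < s → vs zero ≡ vs (fromℕ s) →
  ∀ p → ∃[ q ] vs (inject₁ q) ≡ vs p
closed-position {s = suc s} vs _ closed p with suc s ≟ toℕ p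
... | yes s≡p = zero , trans closed (cong vs (Finₚ.toℕ-injective (trans (Finₚ.toℕ-fromℕ (suc s)) s≡p)))
... | no  s≢p = lower₁ p s≢p , cong vs (Finₚ.inject₁-lower₁ p s≢p)

short-position : ∀ {s} → s < 2 → (p : Fin (suc s)) → p ≡ zero ⊎ p ≡ fromℕ s
short-position {0}           _               zero       = inj₁ refl
short-position {1}           _               zero       = inj₁ refl
short-position {1}           _               (suc zero) = inj₂ refl
short-position {suc (suc s)} (s≤s (s≤s ())) _

interior : ∀ {s} → Fin (s ∸ 1) → Fin (suc s)
interior {suc s} r = suc (inject₁ r)

interior-injective : ∀ {s} → Injective _≡_ _≡_ (interior {s})
interior-injective {suc s} = Finₚ.inject₁-injective ∘ Finₚ.suc-injective

interior≢zero : ∀ {s} (r : Fin (s ∸ 1)) → interior {s} r ≢ zero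
interior≢zero {suc s} r ()

interior≢last : ∀ {s} (r : Fin (s ∸ 1)) → interior {s} r ≢ fromℕ s
interior≢last {suc s} r eq = Finₚ.fromℕ≢inject₁ (sym (Finₚ.suc-injective eq))

avoiding : ∀ {s} → Fin s → Fin (s ∸ 1) → Fin s
avoiding {suc s} q = punchIn q

avoiding-injective : ∀ {s} (q : Fin s) → Injective _≡_ _≡_ (avoiding q)
avoiding-injective {suc s} q = Finₚ.punchIn-injective q _ _

avoiding≢ : ∀ {s} (q : Fin s) (r : Fin (s ∸ 1)) → avoiding q r ≢ q
avoiding≢ {suc s} q = Finₚ.punchInᵢ≢i q

numVerts≤size : ∀ {G} (W : Walk G) → IsCycle W → numVerts W ≤ size W
numVerts≤size {G} W (2≤s , closed , _) =
  ≤-trans (length-filter-tabulate≤ _ (λ v → v) (image cycle) on-cycle) (∣image∣≤ cycle)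
  where
  cycle : Fin (size W) → Vertex G
  cycle = verts W ∘ inject₁
  on-cycle : ∀ v → OnWalk v W → v ∈ image cycle
  on-cycle v (p , refl) with closed-position (verts W) (≤-trans (s≤s z≤n) 2≤s) closed p
  ... | q , eq = subst (_∈ image cycle) eq (f∈image cycle q)

module _ (G : Graph) (D : EarDecomposition G) where

  open Reachability G

  -- InPrefix (ear D) i is Before (toℕ i); a natural-number bound lets root-reaches recurse on it.
  Before : ℕ → Vertex G → Set
  Before j v = ∃[ i ] (toℕ i < j × OnWalk v (ear D i))

  KeptBefore : ℕ → EdgePred G
  KeptBefore j f = ∃[ i ] (toℕ i < j × 2 ≤ size (ear D i) × EdgeOnWalk f (ear D i))

  KeptBefore-suc : ∀ {j} f → KeptBefore j f → KeptBefore (suc j) f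
  KeptBefore-suc f (i , i<j , 2≤s , on) = i , m<n⇒m<1+n i<j , 2≤s , on

  root : Vertex G
  root = firstV (ear D zero)

  edges-injective : ∀ i → Injective _≡_ _≡_ (edges (ear D i))
  edges-injective zero = proj₂ (proj₂ (proj₂ (ear0 D)))
  edges-injective (suc i) with earShape D i
  ... | inj₁ (_ , _ , es-inj)     = es-inj
  ... | inj₂ (_ , _ , _ , es-inj) = es-inj

  ear-reach : ∀ i → 2 ≤ size (ear D i) → ∀ p q →
    Reach (KeptBefore (suc (toℕ i))) (verts (ear D i) p) (verts (ear D i) q)
  ear-reach i 2≤s = walk-reach (ear D i) (λ r → i , ≤-refl , 2≤s , r , refl)

  attachment : ∀ i → ∃[ p ] InPrefix (ear D) (suc i) (verts (ear D (suc i)) p)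
  attachment i with earShape D i
  ... | inj₁ path = zero , proj₂ (pathAttach D i path _ (zero , refl)) (inj₁ refl)
  ... | inj₂ cyc with cycleAttach D i cyc
  ...   | _ , ((p , refl) , before) , _ = p , before

  trivial-ear-attached : ∀ i → ¬ 2 ≤ size (ear D (suc i)) → ∀ p →
    InPrefix (ear D) (suc i) (verts (ear D (suc i)) p)
  trivial-ear-attached i 2≰s p with earShape D i
  ... | inj₂ (2≤s , _) = ⊥-elim (2≰s 2≤s)
  ... | inj₁ path with short-position (≰⇒> 2≰s) p
  ...   | inj₁ refl = proj₂ (pathAttach D i path _ (p , refl)) (inj₁ refl)
  ...   | inj₂ refl = proj₂ (pathAttach D i path _ (p , refl)) (inj₂ refl)

  root-reaches-ear : ∀ i {j} → toℕ i ≡ j → (∀ w → Before j w → Reach (KeptBefore j) root w) →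
    ∀ v → OnWalk v (ear D i) → Reach (KeptBefore (suc j)) root v
  root-reaches-ear zero    refl _  v (p , refl) = ear-reach zero (proj₁ (ear0 D)) zero p
  root-reaches-ear (suc i) refl ih v (p , refl) with 2 ≤? size (ear D (suc i)) | attachment i
  ... | yes 2≤s | q , q-before = Reach-mono KeptBefore-suc (ih _ q-before) ◅◅ ear-reach (suc i) 2≤s q p
  ... | no  2≰s | _            = Reach-mono KeptBefore-suc (ih _ (trivial-ear-attached i 2≰s p))

  root-reaches : ∀ j v → Before j v → Reach (KeptBefore j) root v
  root-reaches (suc j) v (i , i<1+j , on) with m≤n⇒m<n∨m≡n (≤-pred i<1+j)
  ... | inj₁ i<j = Reach-mono KeptBefore-suc (root-reaches j v (i , i<j , on))
  ... | inj₂ i≡j = root-reaches-ear i i≡j (root-reaches j) v on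

  keptCount : Fin (suc (t D)) → ℕ
  keptCount i = nontrivialSize (size (ear D i))

  keptEdge : (i : Fin (suc (t D))) → Fin (keptCount i) → Edge G
  keptEdge i = edges (ear D i) ∘ from-nontrivialSize (size (ear D i))

  Kept : Subset (m G)
  Kept = image (flatten keptCount keptEdge)

  ∈Kept⁺ : ∀ i → 2 ≤ size (ear D i) → ∀ p → edges (ear D i) p ∈ Kept
  ∈Kept⁺ i 2≤s p with from-nontrivialSize-surjective 2≤s p
  ... | r , refl with flatten-covers keptCount keptEdge i r
  ...   | q , eq = subst (_∈ Kept) eq (f∈image _ q)

  ∈Kept⁻ : ∀ {e} → e ∈ Kept → ∃[ i ] ∃[ p ] (2 ≤ size (ear D i) × edges (ear D i) p ≡ e)
  ∈Kept⁻ e∈Kept with ∈image⁻ (flatten keptCount keptEdge) e∈Kept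
  ... | q , refl with flatten-index keptCount keptEdge q
  ...   | i , r , eq = i , from-nontrivialSize _ r , from-nontrivialSize⇒2≤ _ r , sym eq

  KeptBefore⊆Kept : ∀ {j} f → KeptBefore j f → f ∈ Kept
  KeptBefore⊆Kept f (i , _ , 2≤s , p , refl) = ∈Kept⁺ i 2≤s p

  Kept-connected : Connected G (_∈ Kept)
  Kept-connected u v = Reach-sym (from-root u) ◅◅ from-root v
    where
    from-root : ∀ w → Reach (_∈ Kept) root w
    from-root w with coversV D w
    ... | i , on = Reach-mono KeptBefore⊆Kept (root-reaches (suc (t D)) w (i , Finₚ.toℕ<n i , on))

  module _ (e : Edge G) where

    Kept∖e : EdgePred G
    Kept∖e = Without G (_∈ Kept) e

    KeptBefore-avoids : ∀ i p → edges (ear D i) p ≡ e → ∀ f → KeptBefore (toℕ i) f → Kept∖e f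
    KeptBefore-avoids i p refl f f-before@(j , j<i , _ , q , refl) =
      KeptBefore⊆Kept f f-before , disjoint D j i q p λ { refl → n≮n _ j<i }

    ends-linked : ∀ i p → edges (ear D i) p ≡ e → Reach Kept∖e (lastV (ear D i)) (firstV (ear D i))
    ends-linked zero    _ _ = subst (Reach Kept∖e _) (sym (proj₁ (proj₂ (ear0 D)))) ε
    ends-linked (suc i) p on-e with earShape D i
    ... | inj₂ (_ , closed , _) = subst (Reach Kept∖e _) (sym closed) ε
    ... | inj₁ path =
      Reach-sym (linked (fromℕ _) (inj₂ refl)) ◅◅ linked zero (inj₁ refl)
      where
      P : Walk G
      P = ear D (suc i)
      linked : ∀ q → verts P q ≡ firstV P ⊎ verts P q ≡ lastV P → Reach Kept∖e root (verts P q)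
      linked q end = Reach-mono (KeptBefore-avoids (suc i) p on-e)
        (root-reaches _ _ (proj₂ (pathAttach D i path _ (q , refl)) end))

    ear-edge-bypassed : ∀ i p → 2 ≤ size (ear D i) → edges (ear D i) p ≡ e →
      Reach Kept∖e (verts (ear D i) (suc p)) (verts (ear D i) (inject₁ p))
    ear-edge-bypassed i p 2≤s on-e = walk-bypass (ear D i) p other-edge-kept (ends-linked i p on-e)
      where
      other-edge-kept : ∀ r → r ≢ p → Kept∖e (edges (ear D i) r)
      other-edge-kept r r≢p = ∈Kept⁺ i 2≤s r , λ on-e′ → r≢p (edges-injective i (trans on-e′ (sym on-e)))

    Kept-step-avoiding : e ∈ Kept → ∀ {x y} → Adj G (_∈ Kept) x y → Reach Kept∖e x y
    Kept-step-avoiding e∈Kept (f , f∈Kept , f-joins) with f Fin.≟ e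
    ... | no f≢e = (f , (f∈Kept , f≢e) , f-joins) ◅ ε
    ... | yes refl with ∈Kept⁻ e∈Kept
    ...   | i , p , 2≤s , on-e
            with Joins-unique f-joins (subst (λ f → Joins G f _ _) on-e (incid (ear D i) p))
    ...     | inj₁ (refl , refl) = Reach-sym (ear-edge-bypassed i p 2≤s on-e)
    ...     | inj₂ (refl , refl) = ear-edge-bypassed i p 2≤s on-e

    Kept-robust : e ∈ Kept → Connected G Kept∖e
    Kept-robust e∈Kept u v = (Kept-step-avoiding e∈Kept ⋆) (Kept-connected u v)

  Fresh : Fin (suc (t D)) → Vertex G → Set
  Fresh i v = OnWalk v (ear D i) × ¬ Before (toℕ i) v

  Fresh-unique : ∀ {i j v} → Fresh i v → Fresh j v → i ≡ j
  Fresh-unique {i} {j} (on-i , new-i) (on-j , new-j) with <-cmp (toℕ i) (toℕ j)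
  ... | tri< i<j _ _ = ⊥-elim (new-j (i , i<j , on-i))
  ... | tri≈ _ i≡j _ = Finₚ.toℕ-injective i≡j
  ... | tri> _ _ j<i = ⊥-elim (new-i (j , j<i , on-j))

  newCount : Fin (suc (t D)) → ℕ
  newCount zero    = size (ear D zero)
  newCount (suc i) = size (ear D (suc i)) ∸ 1

  record FreshVertices (i : Fin (suc (t D))) : Set where
    constructor freshVertices
    field
      vertex           : Fin (newCount i) → Vertex G
      vertex-injective : Injective _≡_ _≡_ vertex
      vertex-fresh     : ∀ r → Fresh i (vertex r)

  open FreshVertices

  fresh-vertices : ∀ i → FreshVertices i
  fresh-vertices zero =
    freshVertices (verts (ear D zero) ∘ inject₁) (proj₁ (proj₂ (proj₂ (ear0 D))))
                  λ r → (inject₁ r , refl) , λ ()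
  fresh-vertices (suc i) with earShape D i
  ... | inj₁ path@(_ , vs-inj , _) = freshVertices (vs ∘ interior) (interior-injective ∘ vs-inj) fresh
    where
    vs : Fin (suc (size (ear D (suc i)))) → Vertex G
    vs = verts (ear D (suc i))
    fresh : ∀ r → Fresh (suc i) (vs (interior r))
    fresh r = (interior r , refl) , λ before →
      [ interior≢zero r ∘ vs-inj , interior≢last r ∘ vs-inj ]′
        (proj₁ (pathAttach D i path _ (interior r , refl)) before)
  ... | inj₂ cyc@(2≤s , closed , vs-inj , _) with cycleAttach D i cyc
  ...   | _ , ((p , refl) , _) , attached-only-at
          with closed-position (verts (ear D (suc i))) (≤-trans (s≤s z≤n) 2≤s) closed p
  ...     | q , vq≡attachment =
    freshVertices (vs ∘ inject₁ ∘ avoiding q) (avoiding-injective q ∘ vs-inj) fresh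
    where
    vs : Fin (suc (size (ear D (suc i)))) → Vertex G
    vs = verts (ear D (suc i))
    fresh : ∀ r → Fresh (suc i) (vs (inject₁ (avoiding q r)))
    fresh r = (inject₁ (avoiding q r) , refl) , λ before →
      avoiding≢ q r (vs-inj (trans (attached-only-at _ (_ , refl) before) (sym vq≡attachment)))

  fresh-count : ∑[ i < suc (t D) ] newCount i ≤ n G
  fresh-count = ∑-injective⇒≤ newCount (vertex ∘ fresh-vertices) (vertex-injective ∘ fresh-vertices)
    λ i j r s i≢j eq → i≢j (Fresh-unique (vertex-fresh (fresh-vertices i) r)
                                         (subst (Fresh j) (sym eq) (vertex-fresh (fresh-vertices j) s)))

  numLongEars≡ : numLongEars D ≡ ∑[ i < t D ] indicator (3 ≤? size (ear D (suc i)))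
  numLongEars≡ = length-filter-tabulate (λ i → 3 ≤? size (ear D (suc i))) (λ i → i)

  later-ears-charge : ∑[ i < t D ] keptCount (suc i) + numLongEars D ≤ 2 * ∑[ i < t D ] newCount (suc i)
  later-ears-charge = begin
    ∑[ i < t D ] keptCount (suc i) + numLongEars D
      ≡⟨ cong (∑[ i < t D ] keptCount (suc i) +_) numLongEars≡ ⟩
    ∑[ i < t D ] keptCount (suc i) + ∑[ i < t D ] indicator (3 ≤? size (ear D (suc i)))
      ≡⟨ ∑-distrib-+ (keptCount ∘ suc) (λ i → indicator (3 ≤? size (ear D (suc i)))) ⟨
    ∑[ i < t D ] (keptCount (suc i) + indicator (3 ≤? size (ear D (suc i))))
      ≤⟨ ∑-mono-≤ (λ i → nontrivialSize+long≤ (size (ear D (suc i)))) ⟩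
    ∑[ i < t D ] (2 * newCount (suc i))
      ≡⟨ *-distribˡ-sum 2 (newCount ∘ suc) ⟨
    2 * ∑[ i < t D ] newCount (suc i) ∎
    where open ≤-Reasoning

  Kept-small : ∣ Kept ∣ ≤ 2 * n G ∸ (numVerts (ear D zero) + numLongEars D)
  Kept-small = m+n≤o⇒m≤o∸n ∣ Kept ∣ (begin
    ∣ Kept ∣ + (numVerts (ear D zero) + numLongEars D)
      ≤⟨ +-mono-≤ (∣image∣≤ (flatten keptCount keptEdge))
                  (+-monoˡ-≤ (numLongEars D) (numVerts≤size (ear D zero) (ear0 D))) ⟩
    (keptCount zero + K) + (s₀ + numLongEars D)
      ≤⟨ +-monoˡ-≤ _ (+-monoˡ-≤ K (nontrivialSize≤ s₀)) ⟩
    (s₀ + K) + (s₀ + numLongEars D)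
      ≡⟨ rearrange s₀ K (numLongEars D) ⟩
    2 * s₀ + (K + numLongEars D)
      ≤⟨ +-monoʳ-≤ (2 * s₀) later-ears-charge ⟩
    2 * s₀ + 2 * C
      ≡⟨ *-distribˡ-+ 2 s₀ C ⟨
    2 * (s₀ + C)
      ≤⟨ *-monoʳ-≤ 2 fresh-count ⟩
    2 * n G ∎)
    where
    open ≤-Reasoning
    s₀ K C : ℕ
    s₀ = size (ear D zero)
    K = ∑[ i < t D ] keptCount (suc i)
    C = ∑[ i < t D ] newCount (suc i)
    rearrange : ∀ a k l → (a + k) + (a + l) ≡ 2 * a + (k + l)
    rearrange = solve-∀

lemma11 : (G : Graph) → TwoEdgeConnected G → (D : EarDecomposition G) →
    ∃[ T ] (UnsafeSpanningConnected G T ×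
      ∣ T ∣ ≤ 2 * n G ∸ (numVerts (ear D zero) + numLongEars D))
lemma11 G _ D = Kept G D , (Kept-connected G D , λ e e∈Kept _ → Kept-robust G D e e∈Kept) , Kept-small G D
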